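{- Let $H$ be a finite loop-free multigraph on a vertex set $V$. In the loop-free multigraph game with target $H$, the Angel has a winning strategy for every starting position; that is, for every loop-free multigraph $G$ on $V$ in which every vertex has the same degree as in $H$, the Angel has a strategy such that, whatever the Devil's choices, she is always able to move and $H$ is reached after finitely many moves.
   Context: A loop-free multigraph is a finite undirected graph without loops in which several edges may join the same pair of distinct vertices. The type of an edge joining $u$ and $v$ is the unordered pair $\{u,v\}$, and its multiplicity in a graph is the number of edges of that type. Two edges are incident if they share at least one vertex. Given two distinct edges of types $\{v_1,v_2\}$ and $\{v_3,v_4\}$, the double edge swap $(v_1,v_2)(v_3,v_4)$ removes them and adds edges of types $\{v_2,v_3\}$ and $\{v_4,v_1\}$; a double edge swap on two edges $e,e'$ means any such swap with $e,e'$ as the removed edges. The loop-free multigraph game with target $H$: starting from a loop-free multigraph $G$ on $V$ such that every vertex has the same degree in $G$ as in $H$, in each move the Devil chooses any edge $e$ of the current graph $G$ whose type has larger multiplicity in $G$ than in $H$, and then the Angel chooses any edge $e'$ of $G$ not incident to $e$ and performs a double edge swap on $e$ and $e'$ in $G$. The Angel wins if she reaches $H$ (i.e. every type has the same multiplicity in the current graph as in $H$); the Devil wins if the game goes on forever or if the Angel cannot make a move. -}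

module Defs where

open import Data.Nat using (ℕ; zero; suc; _+_; _<_)
open import Data.Fin using (Fin)
open import Data.Fin.Properties using () renaming (_≟_ to _≟F_)
open import Data.Bool using (Bool; true; false; if_then_else_)
open import Data.Product using (_×_; _,_; Σ; ∃)
open import Data.Sum using (_⊎_)
open import Data.List using (List; []; _∷_)
open import Data.List.Membership.Propositional using (_∈_)
open import Data.List.Relation.Unary.All using (All)
open import Relation.Nullary using (¬_; Dec; yes; no)
open import Relation.Nullary.Decidable using (⌊_⌋; _×-dec_; _⊎-dec_)
open import Relation.Binary.PropositionalEquality using (_≡_; _≢_)

-- Vertex set V = Fin n.  An edge is recorded by an ordered pair (u , v) of
-- its endpoints; its TYPE is the unordered pair {u , v}.
Edge : ℕ → Set
Edge n = Fin n × Fin n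

Graph : ℕ → Set
Graph n = List (Edge n)

LoopFree : ∀ {n} → Graph n → Set
LoopFree G = All (λ e → Data.Product.proj₁ e ≢ Data.Product.proj₂ e) G

hasType : ∀ {n} → Edge n → Fin n → Fin n → Bool
hasType (u , v) a b = ⌊ ((u ≟F a) ×-dec (v ≟F b)) ⊎-dec ((u ≟F b) ×-dec (v ≟F a)) ⌋

mult : ∀ {n} → Graph n → Fin n → Fin n → ℕ
mult [] a b = 0
mult (e ∷ G) a b = (if hasType e a b then 1 else 0) + mult G a b

-- degree of x in G: number of edges incident to x
-- (for loop-free graphs each edge contributes at most once)
incidentTo : ∀ {n} → Edge n → Fin n → Bool
incidentTo (u , v) x = ⌊ (u ≟F x) ⊎-dec (v ≟F x) ⌋

deg : ∀ {n} → Graph n → Fin n → ℕ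
deg [] x = 0
deg (e ∷ G) x = (if incidentTo e x then 1 else 0) + deg G x

Reached : ∀ {n} → Graph n → Graph n → Set
Reached H G = ∀ a b → mult G a b ≡ mult H a b

NonIncident : ∀ {n} → Edge n → Edge n → Set
NonIncident (a , b) (c , d) = (a ≢ c) × (a ≢ d) × (b ≢ c) × (b ≢ d)

removeOne : ∀ {n} → Edge n → Graph n → Graph n
removeOne e [] = []
removeOne (a , b) ((u , v) ∷ G) with ⌊ (a ≟F u) ×-dec (b ≟F v) ⌋
... | true  = G
... | false = (u , v) ∷ removeOne (a , b) G

orient : ∀ {n} → Bool → Edge n → Edge n
orient false (u , v) = (u , v)
orient true  (u , v) = (v , u)

-- The booleans choose the ordering of
-- the endpoints of e and e' (all double edge swaps on e and e').
doubleSwap : ∀ {n} → Bool → Bool → Edge n → Edge n → Graph n → Graph n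
doubleSwap o o' e e' G with orient o e | orient o' e'
... | (v1 , v2) | (v3 , v4) = (v2 , v3) ∷ (v4 , v1) ∷ removeOne e' (removeOne e G)

-- AngelWins H G : from position G, the Angel has a strategy which, against
-- every choice of the Devil, always has a legal move and reaches H after
-- finitely many moves (inductive, hence every play is finite).
data AngelWins {n : ℕ} (H : Graph n) : Graph n → Set where
  reached : ∀ {G} → Reached H G → AngelWins H G
  move    : ∀ {G} → ¬ Reached H G →
            -- for every Devil choice: an edge e of G whose type has larger
            -- multiplicity in G than in H ...
            (∀ e → e ∈ G → mult H (Data.Product.proj₁ e) (Data.Product.proj₂ e)
                             < mult G (Data.Product.proj₁ e) (Data.Product.proj₂ e) →
              -- ... the Angel chooses an edge e' of G not incident to e and
              -- a double edge swap on e and e', after which she still wins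
              Σ (Edge n) λ e' → (e' ∈ G) × NonIncident e e' ×
                Σ Bool λ o → Σ Bool λ o' → AngelWins H (doubleSwap o o' e e' G)) →
            AngelWins H G

-- The Angel plays so as to decrease the total surplus  Σ_{x,y} (mult G x y ∸ mult H x y)  (summed over
-- ordered pairs, so one edge changes it by at most 2).  When the Devil picks a surplus edge ab, the Angel looks
-- for a vertex c ∉ {a, b} such that {c, a} or {c, b} is in deficit, together with a surplus edge cd, d ∉ {a, b}.
-- Swapping ab, cd into bc, da (resp. ac, db) removes two surplus edges, adds an edge of a deficit type and at
-- most one new surplus edge, so the surplus drops by at least 2.
-- Such c, d exist: otherwise, with p the indicator of the admissible c's and q that of {a, b}, every surplus type
-- {x, y} has p x + p y ≤ q x + q y, every deficit type the reverse, and {a, b} is strictly lighter under p.  But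
-- for every vertex weight w, Σ_{x,y} mult L x y · (w x + w y) = 2 Σ_x deg L x · w x depends only on the degrees
-- of L, so it is the same for G and H, which rules this out.
module Submission where

open import Defs
open import Data.Bool using (Bool; true; false; T; _∧_; _∨_; if_then_else_)
open import Data.Bool.Properties using (∨-comm; ∧-comm; T-∧)
open import Data.Empty using (⊥; ⊥-elim)
open import Data.Fin using (Fin; zero; suc)
open import Data.Fin.Properties using (_≟_; any?; all?)
open import Data.List using ([]; _∷_)
open import Data.List.Membership.Propositional using (_∈_)
open import Data.List.Relation.Binary.Permutation.Propositional as ↭ using (_↭_; ↭-refl; ↭-prep; ↭-swap; ↭-trans)
open import Data.List.Relation.Binary.Permutation.Propositional.Properties using (All-resp-↭; ∈-resp-↭)
open import Data.List.Relation.Unary.All using ([]; _∷_) renaming (head to All-head; tail to All-tail)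
open import Data.List.Relation.Unary.Any using (here; there)
open import Data.Nat using (ℕ; zero; suc; _+_; _*_; _∸_; _≤_; _<_; z≤n; s≤s; s≤s⁻¹; _<?_)
open import Data.Nat.Induction using (<-wellFounded)
open import Data.Nat.Properties hiding (_≟_)
open import Data.Nat.Properties using () renaming (_≟_ to _≟ℕ_)
open import Data.Nat.Tactic.RingSolver using (solve-∀)
open import Algebra.Properties.CommutativeSemigroup +-commutativeSemigroup using (x∙yz≈y∙xz)
open import Algebra.Properties.Semiring.Sum +-*-semiring
  using (sum; sum-syntax; ∑-distrib-+; ∑-comm; sum-cong-≗; sum-replicate-zero; *-distribˡ-sum; *-distribʳ-sum)
open import Data.Product using (_×_; _,_; proj₁; proj₂; Σ; ∃; ∃₂)
open import Data.Sum using (_⊎_; inj₁; inj₂) renaming (swap to ⊎-swap)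
open import Function using (_∘_)
open import Function.Bundles using (module Equivalence)
open import Induction.WellFounded using (Acc; acc)
open import Relation.Binary.Definitions using (tri<; tri≈; tri>)
open import Relation.Binary.PropositionalEquality
open import Relation.Nullary using (¬_; Dec; yes; no)
open import Relation.Nullary.Decidable using (does; _×-dec_; _⊎-dec_; ¬?; toWitness; dec-true; dec-false; isYes≗does)

open Equivalence using (to)

𝟙 : Bool → ℕ
𝟙 b = if b then 1 else 0

δ : ∀ {n} → Fin n → Fin n → ℕ
δ u x = 𝟙 (does (u ≟ x))

𝟙-∧ : ∀ p q → 𝟙 (p ∧ q) ≡ 𝟙 p * 𝟙 q
𝟙-∧ false q = refl
𝟙-∧ true  q = sym (+-identityʳ (𝟙 q))

𝟙-∨ : ∀ p q → (T p → T q → ⊥) → 𝟙 (p ∨ q) ≡ 𝟙 p + 𝟙 q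
𝟙-∨ false q     _  = refl
𝟙-∨ true  false _  = refl
𝟙-∨ true  true  ex = ⊥-elim (ex _ _)

𝟙-yes : ∀ {A : Set} (a? : Dec A) → A → 𝟙 (does a?) ≡ 1
𝟙-yes a? a = cong 𝟙 (dec-true a? a)

𝟙-no : ∀ {A : Set} (a? : Dec A) → ¬ A → 𝟙 (does a?) ≡ 0
𝟙-no a? ¬a = cong 𝟙 (dec-false a? ¬a)

𝟙-mono : ∀ {A B : Set} (a? : Dec A) (b? : Dec B) → (A → B) → 𝟙 (does a?) ≤ 𝟙 (does b?)
𝟙-mono (yes a) b? f = ≤-reflexive (sym (𝟙-yes b? (f a)))
𝟙-mono (no _)  b? f = z≤n

𝟙+-∸-surplus : ∀ t {g h} → (T t → h ≤ g) → (𝟙 t + g) ∸ h ≡ 𝟙 t + (g ∸ h)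
𝟙+-∸-surplus false h≤g = refl
𝟙+-∸-surplus true  h≤g = +-∸-assoc 1 (h≤g _)

𝟙+-∸-deficit : ∀ t {g h} → (T t → g < h) → (𝟙 t + g) ∸ h ≡ g ∸ h
𝟙+-∸-deficit false g<h = refl
𝟙+-∸-deficit true  g<h = trans (m≤n⇒m∸n≡0 (g<h _)) (sym (m≤n⇒m∸n≡0 (<⇒≤ (g<h _))))

𝟙+-∸-≤ : ∀ t g h → (𝟙 t + g) ∸ h ≤ 𝟙 t + (g ∸ h)
𝟙+-∸-≤ false g h = ≤-refl
𝟙+-∸-≤ true  g h = m≤n+o⇒m∸n≤o (suc g) h (subst (suc g ≤_) (sym (+-suc h (g ∸ h))) (s≤s (m≤n+m∸n g h)))

sum-mono-≤ : ∀ {n} {f g : Fin n → ℕ} → (∀ i → f i ≤ g i) → sum f ≤ sum g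
sum-mono-≤ {zero}  f≤g = z≤n
sum-mono-≤ {suc n} f≤g = +-mono-≤ (f≤g zero) (sum-mono-≤ (λ i → f≤g (suc i)))

sum-mono-< : ∀ {n} {f g : Fin n → ℕ} {j} → (∀ i → f i ≤ g i) → f j < g j → sum f < sum g
sum-mono-< {suc n} {j = zero}  f≤g fj<gj = +-mono-<-≤ fj<gj (sum-mono-≤ (λ i → f≤g (suc i)))
sum-mono-< {suc n} {j = suc j} f≤g fj<gj = +-mono-≤-< (f≤g zero) (sum-mono-< (λ i → f≤g (suc i)) fj<gj)

sum-δ : ∀ {n} (u : Fin n) (f : Fin n → ℕ) → ∑[ x < n ] (δ u x * f x) ≡ f u
sum-δ {suc n} zero    f = trans (cong₂ _+_ (+-identityʳ (f zero)) (sum-replicate-zero n)) (+-identityʳ (f zero))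
sum-δ {suc n} (suc u) f = sum-δ {n} u (λ x → f (suc x))

sum-δ-const : ∀ {n} (u : Fin n) → ∑[ x < n ] δ u x ≡ 1
sum-δ-const u = trans (sum-cong-≗ (λ x → sym (*-identityʳ (δ u x)))) (sum-δ u (λ _ → 1))

∑∑-distrib-+ : ∀ {n} (f g : Fin n → Fin n → ℕ) →
               ∑[ x < n ] ∑[ y < n ] (f x y + g x y) ≡ ∑[ x < n ] ∑[ y < n ] f x y + ∑[ x < n ] ∑[ y < n ] g x y
∑∑-distrib-+ {n} f g = trans (sum-cong-≗ (λ x → ∑-distrib-+ (f x) (g x)))
                             (∑-distrib-+ (λ x → ∑[ y < n ] f x y) (λ x → ∑[ y < n ] g x y))

∑∑-mono-≤ : ∀ {n} {f g : Fin n → Fin n → ℕ} → (∀ x y → f x y ≤ g x y) →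
            ∑[ x < n ] ∑[ y < n ] f x y ≤ ∑[ x < n ] ∑[ y < n ] g x y
∑∑-mono-≤ f≤g = sum-mono-≤ (λ x → sum-mono-≤ (f≤g x))

∑∑-mono-< : ∀ {n} {f g : Fin n → Fin n → ℕ} {a b} → (∀ x y → f x y ≤ g x y) → f a b < g a b →
            ∑[ x < n ] ∑[ y < n ] f x y < ∑[ x < n ] ∑[ y < n ] g x y
∑∑-mono-< f≤g fab<gab = sum-mono-< (λ x → sum-mono-≤ (f≤g x)) (sum-mono-< (f≤g _) fab<gab)

private
  rearrange-left : ∀ h k P Q → h * P + h * Q + k * P ≡ (h + k) * P + h * Q
  rearrange-left = solve-∀

  rearrange-right : ∀ h k P Q → h * P + h * Q + k * Q ≡ h * P + (h + k) * Q
  rearrange-right = solve-∀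

  rearrangement-offset-≤ : ∀ h k {P Q} → P ≤ Q → (h + k) * P + h * Q ≤ h * P + (h + k) * Q
  rearrangement-offset-≤ h k {P} {Q} P≤Q = subst₂ _≤_ (rearrange-left h k P Q) (rearrange-right h k P Q)
    (+-monoʳ-≤ (h * P + h * Q) (*-monoʳ-≤ k P≤Q))

  rearrangement-offset-< : ∀ h k {P Q} → P < Q → (h + suc k) * P + h * Q < h * P + (h + suc k) * Q
  rearrangement-offset-< h k {P} {Q} P<Q = subst₂ _<_ (rearrange-left h (suc k) P Q) (rearrange-right h (suc k) P Q)
    (+-monoʳ-< (h * P + h * Q) (*-monoʳ-< (suc k) P<Q))

-- The conclusion is (g − h)(P − Q) ≤ 0, stated without subtraction.
rearrangement-≤ : ∀ {g h P Q} → (h < g → P ≤ Q) → (g < h → Q ≤ P) → g * P + h * Q ≤ h * P + g * Q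
rearrangement-≤ {g} {h} {P} {Q} P≤Q Q≤P with <-cmp h g
... | tri< h<g _ _ = subst (λ g → g * P + h * Q ≤ h * P + g * Q) (m+[n∸m]≡n (<⇒≤ h<g))
                           (rearrangement-offset-≤ h (g ∸ h) (P≤Q h<g))
... | tri≈ _ refl _ = ≤-refl
... | tri> _ _ g<h = subst₂ _≤_ (+-comm (h * Q) (g * P)) (+-comm (g * Q) (h * P))
  (subst (λ h → h * Q + g * P ≤ g * Q + h * P) (m+[n∸m]≡n (<⇒≤ g<h)) (rearrangement-offset-≤ g (h ∸ g) (Q≤P g<h)))

rearrangement-< : ∀ {g h P Q} → h < g → P < Q → g * P + h * Q < h * P + g * Q
rearrangement-< {g} {h} {P} {Q} h<g P<Q = subst (λ g → g * P + h * Q < h * P + g * Q)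
  (trans (+-suc h (g ∸ suc h)) (m+[n∸m]≡n h<g)) (rearrangement-offset-< h (g ∸ suc h) P<Q)

-- Edge types, multiplicities and degrees

module _ {n : ℕ} where

  ≟-sound : ∀ {u x : Fin n} → T (does (u ≟ x)) → u ≡ x
  ≟-sound {u} {x} t with u ≟ x
  ... | yes u≡x = u≡x

  δ-distinct : ∀ {u v x : Fin n} → u ≢ v → T (does (u ≟ x)) → T (does (v ≟ x)) → ⊥
  δ-distinct u≢v t t' = u≢v (trans (≟-sound t) (sym (≟-sound t')))

  hasType-does : ∀ (u v x y : Fin n) →
                 hasType (u , v) x y ≡ (does (u ≟ x) ∧ does (v ≟ y)) ∨ (does (u ≟ y) ∧ does (v ≟ x))
  hasType-does u v x y = isYes≗does _

  incidentTo-does : ∀ (u v x : Fin n) → incidentTo (u , v) x ≡ does (u ≟ x) ∨ does (v ≟ x)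
  incidentTo-does u v x = isYes≗does _

  hasType-sound : ∀ {u v x y : Fin n} → T (hasType (u , v) x y) → (u ≡ x × v ≡ y) ⊎ (u ≡ y × v ≡ x)
  hasType-sound {u} {v} {x} {y} = toWitness {a? = ((u ≟ x) ×-dec (v ≟ y)) ⊎-dec ((u ≟ y) ×-dec (v ≟ x))}

  hasType-self : ∀ (u v : Fin n) → hasType (u , v) u v ≡ true
  hasType-self u v =
    trans (isYes≗does _) (dec-true (((u ≟ u) ×-dec (v ≟ v)) ⊎-dec ((u ≟ v) ×-dec (v ≟ u))) (inj₁ (refl , refl)))

  hasType-absent : ∀ {u v x y : Fin n} → u ≢ x → u ≢ y → hasType (u , v) x y ≡ false
  hasType-absent {u} {v} {x} {y} u≢x u≢y = trans (isYes≗does _)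
    (dec-false (((u ≟ x) ×-dec (v ≟ y)) ⊎-dec ((u ≟ y) ×-dec (v ≟ x)))
               λ { (inj₁ (u≡x , _)) → u≢x u≡x ; (inj₂ (u≡y , _)) → u≢y u≡y })

  hasType-comm : ∀ (e : Edge n) x y → hasType e x y ≡ hasType e y x
  hasType-comm (u , v) x y =
    trans (hasType-does u v x y) (trans (∨-comm (does (u ≟ x) ∧ does (v ≟ y)) _) (sym (hasType-does u v y x)))

  hasType-orient : ∀ o (e : Edge n) x y → hasType (orient o e) x y ≡ hasType e x y
  hasType-orient false e       x y = refl
  hasType-orient true  (u , v) x y = begin
    hasType (v , u) x y
      ≡⟨ hasType-does v u x y ⟩
    (does (v ≟ x) ∧ does (u ≟ y)) ∨ (does (v ≟ y) ∧ does (u ≟ x))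
      ≡⟨ cong₂ _∨_ (∧-comm (does (v ≟ x)) _) (∧-comm (does (v ≟ y)) _) ⟩
    (does (u ≟ y) ∧ does (v ≟ x)) ∨ (does (u ≟ x) ∧ does (v ≟ y))
      ≡⟨ ∨-comm (does (u ≟ y) ∧ does (v ≟ x)) _ ⟩
    (does (u ≟ x) ∧ does (v ≟ y)) ∨ (does (u ≟ y) ∧ does (v ≟ x))
      ≡⟨ hasType-does u v x y ⟨
    hasType (u , v) x y
      ∎
    where open ≡-Reasoning

  orient-of-type : ∀ (e : Edge n) {x y} → T (hasType e x y) → ∃ λ o → orient o e ≡ (x , y)
  orient-of-type (u , v) t with hasType-sound t
  ... | inj₁ (refl , refl) = false , refl
  ... | inj₂ (refl , refl) = true , refl

  hasType-δ : ∀ {u v : Fin n} → u ≢ v → ∀ x y → 𝟙 (hasType (u , v) x y) ≡ δ u x * δ v y + δ u y * δ v x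
  hasType-δ {u} {v} u≢v x y =
    trans (cong 𝟙 (hasType-does u v x y))
          (trans (𝟙-∨ _ _ excl) (cong₂ _+_ (𝟙-∧ (does (u ≟ x)) _) (𝟙-∧ (does (u ≟ y)) _)))
    where
    excl : T (does (u ≟ x) ∧ does (v ≟ y)) → T (does (u ≟ y) ∧ does (v ≟ x)) → ⊥
    excl t t' = δ-distinct u≢v (proj₁ (T-∧ .to t)) (proj₂ (T-∧ .to t'))

  incidentTo-δ : ∀ {u v : Fin n} → u ≢ v → ∀ x → 𝟙 (incidentTo (u , v) x) ≡ δ u x + δ v x
  incidentTo-δ {u} {v} u≢v x = trans (cong 𝟙 (incidentTo-does u v x)) (𝟙-∨ (does (u ≟ x)) _ (δ-distinct u≢v))

  mult-comm : ∀ (L : Graph n) x y → mult L x y ≡ mult L y x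
  mult-comm []      x y = refl
  mult-comm (e ∷ L) x y = cong₂ _+_ (cong 𝟙 (hasType-comm e x y)) (mult-comm L x y)

  mult-comm-< : ∀ (L L' : Graph n) {x y} → mult L x y < mult L' x y → mult L y x < mult L' y x
  mult-comm-< L L' {x} {y} = subst₂ _<_ (mult-comm L x y) (mult-comm L' x y)

  mult-of-type : ∀ (L : Graph n) {u v x y} → T (hasType (u , v) x y) → mult L x y ≡ mult L u v
  mult-of-type L t with hasType-sound t
  ... | inj₁ (refl , refl) = refl
  ... | inj₂ (refl , refl) = mult-comm L _ _

  mult-at-type : ∀ (R : ℕ → ℕ → Set) (L L' : Graph n) {u v x y} → T (hasType (u , v) x y) →
                 R (mult L u v) (mult L' u v) → R (mult L x y) (mult L' x y)
  mult-at-type R L L' t = subst₂ R (sym (mult-of-type L t)) (sym (mult-of-type L' t))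

  mult-∷-≤ : ∀ e (L : Graph n) x y → mult L x y ≤ mult (e ∷ L) x y
  mult-∷-≤ e L x y = m≤n+m (mult L x y) (𝟙 (hasType e x y))

  mult-loop : ∀ {L : Graph n} → LoopFree L → ∀ x → mult L x x ≡ 0
  mult-loop []                         x = refl
  mult-loop {(u , v) ∷ L} (u≢v ∷ lf) x = cong₂ _+_ (cong 𝟙 (loop (u ≟ x))) (mult-loop lf x)
    where
    loop : Dec (u ≡ x) → hasType (u , v) x x ≡ false
    loop (no  u≢x)  = hasType-absent u≢x u≢x
    loop (yes refl) = trans (sym (hasType-orient true (u , v) x x)) (hasType-absent (u≢v ∘ sym) (u≢v ∘ sym))

  member-of-type : ∀ (L : Graph n) {x y} → 0 < mult L x y → ∃ λ e → e ∈ L × T (hasType e x y)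
  member-of-type (e ∷ L) {x} {y} pos with hasType e x y in eq
  ... | true  = e , here refl , subst T (sym eq) _
  ... | false = let (e' , e'∈ , t) = member-of-type L pos in e' , there e'∈ , t

  ∑-hasType : ∀ {u v : Fin n} → u ≢ v → ∀ x → ∑[ y < n ] 𝟙 (hasType (u , v) x y) ≡ 𝟙 (incidentTo (u , v) x)
  ∑-hasType {u} {v} u≢v x = begin
    ∑[ y < n ] 𝟙 (hasType (u , v) x y)
      ≡⟨ sum-cong-≗ (hasType-δ u≢v x) ⟩
    ∑[ y < n ] (δ u x * δ v y + δ u y * δ v x)
      ≡⟨ ∑-distrib-+ (λ y → δ u x * δ v y) (λ y → δ u y * δ v x) ⟩
    ∑[ y < n ] (δ u x * δ v y) + ∑[ y < n ] (δ u y * δ v x)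
      ≡⟨ cong₂ _+_ (sym (*-distribˡ-sum (δ u x) (δ v))) (sum-δ u (λ _ → δ v x)) ⟩
    δ u x * ∑[ y < n ] δ v y + δ v x
      ≡⟨ cong (λ s → δ u x * s + δ v x) (sum-δ-const v) ⟩
    δ u x * 1 + δ v x
      ≡⟨ cong (_+ δ v x) (*-identityʳ (δ u x)) ⟩
    δ u x + δ v x
      ≡⟨ incidentTo-δ u≢v x ⟨
    𝟙 (incidentTo (u , v) x)
      ∎
    where open ≡-Reasoning

  ∑∑-hasType : ∀ {u v : Fin n} → u ≢ v → ∑[ x < n ] ∑[ y < n ] 𝟙 (hasType (u , v) x y) ≡ 2
  ∑∑-hasType {u} {v} u≢v = begin
    ∑[ x < n ] ∑[ y < n ] 𝟙 (hasType (u , v) x y)  ≡⟨ sum-cong-≗ (∑-hasType u≢v) ⟩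
    ∑[ x < n ] 𝟙 (incidentTo (u , v) x)            ≡⟨ sum-cong-≗ (incidentTo-δ u≢v) ⟩
    ∑[ x < n ] (δ u x + δ v x)                      ≡⟨ ∑-distrib-+ (δ u) (δ v) ⟩
    ∑[ x < n ] δ u x + ∑[ x < n ] δ v x             ≡⟨ cong₂ _+_ (sum-δ-const u) (sum-δ-const v) ⟩
    2                                               ∎
    where open ≡-Reasoning

  deg≡∑mult : ∀ {L : Graph n} → LoopFree L → ∀ x → deg L x ≡ ∑[ y < n ] mult L x y
  deg≡∑mult []                         x = sym (sum-replicate-zero n)
  deg≡∑mult {(u , v) ∷ L} (u≢v ∷ lf) x = begin
    𝟙 (incidentTo (u , v) x) + deg L x                          ≡⟨ cong₂ _+_ (sym (∑-hasType u≢v x)) (deg≡∑mult lf x) ⟩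
    ∑[ y < n ] 𝟙 (hasType (u , v) x y) + ∑[ y < n ] mult L x y  ≡⟨ ∑-distrib-+ _ (mult L x) ⟨
    ∑[ y < n ] mult ((u , v) ∷ L) x y                           ∎
    where open ≡-Reasoning

  deg-cong : ∀ {L L' : Graph n} → LoopFree L → LoopFree L' → (∀ x y → mult L x y ≡ mult L' x y) →
             ∀ x → deg L x ≡ deg L' x
  deg-cong lf lf' L≈L' x = trans (deg≡∑mult lf x) (trans (sum-cong-≗ (L≈L' x)) (sym (deg≡∑mult lf' x)))

-- Equal degrees balance every vertex weight

  weight : Graph n → (Fin n → ℕ) → ℕ
  weight L p = ∑[ x < n ] ∑[ y < n ] (mult L x y * (p x + p y))

  weight-deg : ∀ {L : Graph n} → LoopFree L → ∀ p →
               weight L p ≡ ∑[ x < n ] (deg L x * p x) + ∑[ x < n ] (deg L x * p x)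
  weight-deg {L} lf p = begin
    ∑[ x < n ] ∑[ y < n ] (mult L x y * (p x + p y))
      ≡⟨ sum-cong-≗ (λ x → sum-cong-≗ (λ y → *-distribˡ-+ (mult L x y) (p x) (p y))) ⟩
    ∑[ x < n ] ∑[ y < n ] (mult L x y * p x + mult L x y * p y)
      ≡⟨ ∑∑-distrib-+ (λ x y → mult L x y * p x) (λ x y → mult L x y * p y) ⟩
    ∑[ x < n ] ∑[ y < n ] (mult L x y * p x) + ∑[ x < n ] ∑[ y < n ] (mult L x y * p y)
      ≡⟨ cong₂ _+_ ∑∑-mult-* (trans ∑∑-mult-*-comm ∑∑-mult-*) ⟩
    ∑[ x < n ] (deg L x * p x) + ∑[ x < n ] (deg L x * p x)
      ∎
    where
    open ≡-Reasoning
    ∑∑-mult-* : ∑[ x < n ] ∑[ y < n ] (mult L x y * p x) ≡ ∑[ x < n ] (deg L x * p x)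
    ∑∑-mult-* = sum-cong-≗ λ x → trans (sym (*-distribʳ-sum (p x) (mult L x))) (cong (_* p x) (sym (deg≡∑mult lf x)))
    ∑∑-mult-*-comm : ∑[ x < n ] ∑[ y < n ] (mult L x y * p y) ≡ ∑[ x < n ] ∑[ y < n ] (mult L x y * p x)
    ∑∑-mult-*-comm = trans (∑-comm (λ x y → mult L x y * p y))
                           (sum-cong-≗ λ x → sum-cong-≗ λ y → cong (_* p x) (mult-comm L y x))

  surplus-not-lighter : ∀ {G H : Graph n} → LoopFree G → LoopFree H → (∀ x → deg G x ≡ deg H x) →
    ∀ (p q : Fin n → ℕ) →
    (∀ x y → mult H x y < mult G x y → p x + p y ≤ q x + q y) →
    (∀ x y → mult G x y < mult H x y → q x + q y ≤ p x + p y) →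
    ∀ {a b} → mult H a b < mult G a b → ¬ (p a + p b < q a + q b)
  surplus-not-lighter {G} {H} lG lH deg≡ p q surplus⇒ deficit⇒ surplus lighter = <-irrefl same-total strict-total
    where
    weighted : Graph n → (Fin n → ℕ) → Fin n → Fin n → ℕ
    weighted L r x y = mult L x y * (r x + r y)
    strict-total : weight G p + weight H q < weight H p + weight G q
    strict-total = subst₂ _<_ (∑∑-distrib-+ (weighted G p) (weighted H q)) (∑∑-distrib-+ (weighted H p) (weighted G q))
      (∑∑-mono-< (λ x y → rearrangement-≤ (surplus⇒ x y) (deficit⇒ x y)) (rearrangement-< surplus lighter))
    balanced : ∀ r → weight G r ≡ weight H r
    balanced r = trans (weight-deg lG r)
      (trans (cong (λ s → s + s) (sum-cong-≗ λ x → cong (_* r x) (deg≡ x))) (sym (weight-deg lH r)))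
    same-total : weight G p + weight H q ≡ weight H p + weight G q
    same-total = cong₂ _+_ (balanced p) (sym (balanced q))

-- The Angel's swap partner

module SwapPartner {n} {G H : Graph n} (lG : LoopFree G) (lH : LoopFree H) (deg≡ : ∀ x → deg G x ≡ deg H x)
                   {a b : Fin n} (surplus : mult H a b < mult G a b) where

  End : Fin n → Set
  End x = x ≡ a ⊎ x ≡ b

  end? : ∀ x → Dec (End x)
  end? x = (x ≟ a) ⊎-dec (x ≟ b)

  Near : Fin n → Set
  Near x = ¬ End x × (mult G x a < mult H x a ⊎ mult G x b < mult H x b)

  near? : ∀ x → Dec (Near x)
  near? x = ¬? (end? x) ×-dec ((mult G x a <? mult H x a) ⊎-dec (mult G x b <? mult H x b))

  Partner : Fin n → Fin n → Set
  Partner c d = Near c × ¬ End d × mult H c d < mult G c d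

  deficit-avoids-ends : ∀ {x y} → End x → mult G x y < mult H x y → ¬ End y
  deficit-avoids-ends (inj₁ refl) d (inj₁ refl) = n≮0 (subst (_ <_) (mult-loop lH a) d)
  deficit-avoids-ends (inj₂ refl) d (inj₂ refl) = n≮0 (subst (_ <_) (mult-loop lH b) d)
  deficit-avoids-ends (inj₁ refl) d (inj₂ refl) = <-asym surplus d
  deficit-avoids-ends (inj₂ refl) d (inj₁ refl) = <-asym surplus (mult-comm-< G H d)

  deficit-from-end : ∀ {x y} → mult G x y < mult H x y → End x → Near y
  deficit-from-end d (inj₁ refl) = deficit-avoids-ends (inj₁ refl) d , inj₁ (mult-comm-< G H d)
  deficit-from-end d (inj₂ refl) = deficit-avoids-ends (inj₂ refl) d , inj₂ (mult-comm-< G H d)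

  swap-partner : ∃₂ Partner
  swap-partner with any? (λ c → any? (λ d → near? c ×-dec ¬? (end? d) ×-dec (mult H c d <? mult G c d)))
  ... | yes found = found
  ... | no  none  = ⊥-elim (surplus-not-lighter lG lH deg≡ p q surplus⇒ deficit⇒ surplus ends-heavier)
    where
    p q : Fin n → ℕ
    p x = 𝟙 (does (near? x))
    q x = 𝟙 (does (end? x))

    surplus-to-end : ∀ {x y} → mult H x y < mult G x y → Near x → End y
    surplus-to-end {x} {y} s nx with end? y
    ... | yes ey = ey
    ... | no ¬ey = ⊥-elim (none (x , y , nx , ¬ey , s))

    surplus⇒ : ∀ x y → mult H x y < mult G x y → p x + p y ≤ q x + q y
    surplus⇒ x y s = subst (p x + p y ≤_) (+-comm (q y) (q x))
      (+-mono-≤ (𝟙-mono (near? x) (end? y) (surplus-to-end s))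
                (𝟙-mono (near? y) (end? x) (surplus-to-end (mult-comm-< H G s))))

    deficit⇒ : ∀ x y → mult G x y < mult H x y → q x + q y ≤ p x + p y
    deficit⇒ x y d = subst (q x + q y ≤_) (+-comm (p y) (p x))
      (+-mono-≤ (𝟙-mono (end? x) (near? y) (deficit-from-end d))
                (𝟙-mono (end? y) (near? x) (deficit-from-end (mult-comm-< G H d))))

    ends-heavier : p a + p b < q a + q b
    ends-heavier = subst₂ _<_
      (sym (cong₂ _+_ (𝟙-no (near? a) (λ na → proj₁ na (inj₁ refl)))
                      (𝟙-no (near? b) (λ nb → proj₁ nb (inj₂ refl)))))
      (sym (cong (_+ q b) (𝟙-yes (end? a) (inj₁ refl))))
      (s≤s z≤n)

-- Double edge swaps

module _ {n : ℕ} where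

  orient-≢ : ∀ o (e : Edge n) → proj₁ e ≢ proj₂ e → proj₁ (orient o e) ≢ proj₂ (orient o e)
  orient-≢ false e u≢v = u≢v
  orient-≢ true  e u≢v = u≢v ∘ sym

  NonIncident-orient : ∀ o o' (e e' : Edge n) → NonIncident (orient o e) (orient o' e') → NonIncident e e'
  NonIncident-orient false false e e' ni = ni
  NonIncident-orient true  false e e' (b≢c , b≢d , a≢c , a≢d) = a≢c , a≢d , b≢c , b≢d
  NonIncident-orient false true  e e' (a≢d , a≢c , b≢d , b≢c) = a≢c , a≢d , b≢c , b≢d
  NonIncident-orient true  true  e e' (b≢d , b≢c , a≢d , a≢c) = a≢c , a≢d , b≢c , b≢d

  NonIncident⇒≢ : ∀ {e e' : Edge n} → NonIncident e e' → e' ≢ e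
  NonIncident⇒≢ (a≢c , _) e'≡e = a≢c (cong proj₁ (sym e'≡e))

  avoids⇒NonIncident : ∀ {a b c d : Fin n} → ¬ (c ≡ a ⊎ c ≡ b) → ¬ (d ≡ a ⊎ d ≡ b) → NonIncident (a , b) (c , d)
  avoids⇒NonIncident c∉ d∉ = c∉ ∘ inj₁ ∘ sym , d∉ ∘ inj₁ ∘ sym , c∉ ∘ inj₂ ∘ sym , d∉ ∘ inj₂ ∘ sym

  removeOne-↭ : ∀ {e : Edge n} {L} → e ∈ L → L ↭ e ∷ removeOne e L
  removeOne-↭ {a , b} {(u , v) ∷ L} e∈ with a ≟ u | b ≟ v | e∈
  ... | yes refl | yes refl | _         = ↭-refl
  ... | yes _    | no b≢v   | here refl = ⊥-elim (b≢v refl)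
  ... | no a≢u   | _        | here refl = ⊥-elim (a≢u refl)
  ... | yes _    | no _     | there e∈L = ↭-trans (↭-prep _ (removeOne-↭ e∈L)) (↭-swap _ _ ↭-refl)
  ... | no _     | _        | there e∈L = ↭-trans (↭-prep _ (removeOne-↭ e∈L)) (↭-swap _ _ ↭-refl)

  removeTwo-↭ : ∀ {e e' : Edge n} {G} → e ∈ G → e' ∈ G → e' ≢ e → G ↭ e ∷ e' ∷ removeOne e' (removeOne e G)
  removeTwo-↭ e∈ e'∈ e'≢e =
    ↭-trans (removeOne-↭ e∈) (↭-prep _ (removeOne-↭ (drop-head (∈-resp-↭ (removeOne-↭ e∈) e'∈))))
    where
    drop-head : ∀ {L} → _ ∈ _ ∷ L → _ ∈ L
    drop-head (here e'≡e)  = ⊥-elim (e'≢e e'≡e)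
    drop-head (there e'∈L) = e'∈L

  mult-↭ : ∀ {L L' : Graph n} → L ↭ L' → ∀ x y → mult L x y ≡ mult L' x y
  mult-↭ ↭.refl          x y = refl
  mult-↭ (↭.prep e p)    x y = cong (𝟙 (hasType e x y) +_) (mult-↭ p x y)
  mult-↭ (↭.swap e e' p) x y =
    trans (cong (λ m → 𝟙 (hasType e x y) + (𝟙 (hasType e' x y) + m)) (mult-↭ p x y))
          (x∙yz≈y∙xz (𝟙 (hasType e x y)) (𝟙 (hasType e' x y)) _)
  mult-↭ (↭.trans p q)   x y = trans (mult-↭ p x y) (mult-↭ q x y)

  mult-orient-∷ : ∀ o (e : Edge n) {u v} L → orient o e ≡ (u , v) →
                  ∀ x y → mult (e ∷ L) x y ≡ mult ((u , v) ∷ L) x y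
  mult-orient-∷ o e L eo x y =
    cong (λ t → 𝟙 t + mult L x y) (trans (sym (hasType-orient o e x y)) (cong (λ f → hasType f x y) eo))

  doubleSwap-orient : ∀ o o' (e e' : Edge n) G {v₁ v₂ v₃ v₄} → orient o e ≡ (v₁ , v₂) → orient o' e' ≡ (v₃ , v₄) →
                      doubleSwap o o' e e' G ≡ (v₂ , v₃) ∷ (v₄ , v₁) ∷ removeOne e' (removeOne e G)
  doubleSwap-orient false false _ _ G refl refl = refl
  doubleSwap-orient false true  _ _ G refl refl = refl
  doubleSwap-orient true  false _ _ G refl refl = refl
  doubleSwap-orient true  true  _ _ G refl refl = refl

  doubleSwap-source : ∀ {G : Graph n} {e e' : Edge n} o o' {v₁ v₂ v₃ v₄} → LoopFree G → e ∈ G → e' ∈ G → e' ≢ e →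
    orient o e ≡ (v₁ , v₂) → orient o' e' ≡ (v₃ , v₄) →
    let R = removeOne e' (removeOne e G) in
    (∀ x y → mult G x y ≡ mult ((v₁ , v₂) ∷ (v₃ , v₄) ∷ R) x y) × LoopFree ((v₁ , v₂) ∷ (v₃ , v₄) ∷ R)
  doubleSwap-source {G} {e} {e'} o o' {v₁} {v₂} {v₃} {v₄} lG e∈ e'∈ e'≢e eo eo' =
    G≈F , v₁≢v₂ ∷ v₃≢v₄ ∷ All-tail (All-tail lEE′R)
    where
    R = removeOne e' (removeOne e G)
    G↭ : G ↭ e ∷ e' ∷ R
    G↭ = removeTwo-↭ e∈ e'∈ e'≢e
    G≈F : ∀ x y → mult G x y ≡ mult ((v₁ , v₂) ∷ (v₃ , v₄) ∷ R) x y
    G≈F x y = trans (mult-↭ G↭ x y)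
      (trans (mult-orient-∷ o e (e' ∷ R) eo x y) (cong (𝟙 (hasType (v₁ , v₂) x y) +_) (mult-orient-∷ o' e' R eo' x y)))
    lEE′R : LoopFree (e ∷ e' ∷ R)
    lEE′R = All-resp-↭ G↭ lG
    v₁≢v₂ : v₁ ≢ v₂
    v₁≢v₂ = subst (λ f → proj₁ f ≢ proj₂ f) eo (orient-≢ o e (All-head lEE′R))
    v₃≢v₄ : v₃ ≢ v₄
    v₃≢v₄ = subst (λ f → proj₁ f ≢ proj₂ f) eo' (orient-≢ o' e' (All-head (All-tail lEE′R)))

  swap-deg : ∀ {v₁ v₂ v₃ v₄ : Fin n} (R : Graph n) → v₁ ≢ v₂ → v₃ ≢ v₄ → NonIncident (v₁ , v₂) (v₃ , v₄) →
             ∀ x → deg ((v₂ , v₃) ∷ (v₄ , v₁) ∷ R) x ≡ deg ((v₁ , v₂) ∷ (v₃ , v₄) ∷ R) x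
  swap-deg {v₁} {v₂} {v₃} {v₄} R v₁≢v₂ v₃≢v₄ (_ , v₁≢v₄ , v₂≢v₃ , _) x = begin
    𝟙 (incidentTo (v₂ , v₃) x) + (𝟙 (incidentTo (v₄ , v₁) x) + deg R x)
      ≡⟨ cong₂ (λ i j → i + (j + deg R x)) (incidentTo-δ v₂≢v₃ x) (incidentTo-δ (v₁≢v₄ ∘ sym) x) ⟩
    (δ v₂ x + δ v₃ x) + ((δ v₄ x + δ v₁ x) + deg R x)
      ≡⟨ rotate (δ v₁ x) (δ v₂ x) (δ v₃ x) (δ v₄ x) (deg R x) ⟩
    (δ v₁ x + δ v₂ x) + ((δ v₃ x + δ v₄ x) + deg R x)
      ≡⟨ cong₂ (λ i j → i + (j + deg R x)) (incidentTo-δ v₁≢v₂ x) (incidentTo-δ v₃≢v₄ x) ⟨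
    𝟙 (incidentTo (v₁ , v₂) x) + (𝟙 (incidentTo (v₃ , v₄) x) + deg R x)
      ∎
    where
    open ≡-Reasoning
    rotate : ∀ a b c d r → (b + c) + ((d + a) + r) ≡ (a + b) + ((c + d) + r)
    rotate = solve-∀

-- The surplus potential

module Excess {n} (H : Graph n) where

  excess : Graph n → ℕ
  excess L = ∑[ x < n ] ∑[ y < n ] (mult L x y ∸ mult H x y)

  excess-cong : ∀ {L L' : Graph n} → (∀ x y → mult L x y ≡ mult L' x y) → excess L ≡ excess L'
  excess-cong L≈L' = sum-cong-≗ λ x → sum-cong-≗ λ y → cong (_∸ mult H x y) (L≈L' x y)

  private
    excess-∷-split : ∀ {u v : Fin n} (L : Graph n) → u ≢ v →
      ∑[ x < n ] ∑[ y < n ] (𝟙 (hasType (u , v) x y) + (mult L x y ∸ mult H x y)) ≡ 2 + excess L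
    excess-∷-split {u} {v} L u≢v =
      trans (∑∑-distrib-+ (λ x y → 𝟙 (hasType (u , v) x y)) (λ x y → mult L x y ∸ mult H x y))
            (cong (_+ excess L) (∑∑-hasType u≢v))

  excess-∷-surplus : ∀ {u v : Fin n} {L} → u ≢ v → mult H u v < mult ((u , v) ∷ L) u v →
                     excess ((u , v) ∷ L) ≡ 2 + excess L
  excess-∷-surplus {u} {v} {L} u≢v surplus = trans
    (sum-cong-≗ λ x → sum-cong-≗ λ y → 𝟙+-∸-surplus (hasType (u , v) x y) (λ t → mult-at-type _≤_ H L t h≤g))
    (excess-∷-split L u≢v)
    where
    h≤g : mult H u v ≤ mult L u v
    h≤g = s≤s⁻¹ (subst (mult H u v <_) (cong (λ t → 𝟙 t + mult L u v) (hasType-self u v)) surplus)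

  excess-∷-deficit : ∀ {u v : Fin n} {L} → mult L u v < mult H u v → excess ((u , v) ∷ L) ≡ excess L
  excess-∷-deficit {u} {v} {L} deficit =
    sum-cong-≗ λ x → sum-cong-≗ λ y → 𝟙+-∸-deficit (hasType (u , v) x y) (λ t → mult-at-type _<_ L H t deficit)

  excess-∷-≤ : ∀ {u v : Fin n} {L} → u ≢ v → excess ((u , v) ∷ L) ≤ 2 + excess L
  excess-∷-≤ {u} {v} {L} u≢v =
    ≤-trans (∑∑-mono-≤ λ x y → 𝟙+-∸-≤ (hasType (u , v) x y) (mult L x y) (mult H x y))
            (≤-reflexive (excess-∷-split L u≢v))

  swap-excess : ∀ {v₁ v₂ v₃ v₄ : Fin n} (R : Graph n) → v₁ ≢ v₂ → v₃ ≢ v₄ → NonIncident (v₁ , v₂) (v₃ , v₄) →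
    mult H v₁ v₂ < mult ((v₁ , v₂) ∷ (v₃ , v₄) ∷ R) v₁ v₂ →
    mult H v₃ v₄ < mult ((v₁ , v₂) ∷ (v₃ , v₄) ∷ R) v₃ v₄ →
    mult ((v₁ , v₂) ∷ (v₃ , v₄) ∷ R) v₂ v₃ < mult H v₂ v₃ →
    excess ((v₂ , v₃) ∷ (v₄ , v₁) ∷ R) < excess ((v₁ , v₂) ∷ (v₃ , v₄) ∷ R)
  swap-excess {v₁} {v₂} {v₃} {v₄} R v₁≢v₂ v₃≢v₄ (v₁≢v₃ , v₁≢v₄ , _ , v₂≢v₄) s₁₂ s₃₄ d₂₃ =
    begin-strict
    excess ((v₂ , v₃) ∷ (v₄ , v₁) ∷ R)  ≡⟨ excess-∷-deficit {v₂} {v₃} {(v₄ , v₁) ∷ R} d₂₃′ ⟩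
    excess ((v₄ , v₁) ∷ R)              ≤⟨ excess-∷-≤ {v₄} {v₁} {R} (v₁≢v₄ ∘ sym) ⟩
    2 + excess R                        <⟨ m<n+m (2 + excess R) {2} (s≤s z≤n) ⟩
    2 + (2 + excess R)                  ≡⟨ cong (2 +_) (excess-∷-surplus {v₃} {v₄} {R} v₃≢v₄ s₃₄′) ⟨
    2 + excess ((v₃ , v₄) ∷ R)          ≡⟨ excess-∷-surplus {v₁} {v₂} {(v₃ , v₄) ∷ R} v₁≢v₂ s₁₂ ⟨
    excess ((v₁ , v₂) ∷ (v₃ , v₄) ∷ R) ∎
    where
    open ≤-Reasoning
    s₃₄′ : mult H v₃ v₄ < mult ((v₃ , v₄) ∷ R) v₃ v₄
    s₃₄′ = subst (mult H v₃ v₄ <_)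
                 (cong (λ t → 𝟙 t + mult ((v₃ , v₄) ∷ R) v₃ v₄) (hasType-absent v₁≢v₃ v₁≢v₄)) s₃₄
    d₂₃′ : mult ((v₄ , v₁) ∷ R) v₂ v₃ < mult H v₂ v₃
    d₂₃′ = ≤-<-trans
      (≤-trans (≤-reflexive (cong (λ t → 𝟙 t + mult R v₂ v₃) (hasType-absent (v₂≢v₄ ∘ sym) (v₃≢v₄ ∘ sym))))
               (≤-trans (mult-∷-≤ (v₃ , v₄) R v₂ v₃) (mult-∷-≤ (v₁ , v₂) ((v₃ , v₄) ∷ R) v₂ v₃)))
      d₂₃

module Game {n} (H : Graph n) (lH : LoopFree H) where

  open Excess H

  Position : Graph n → Set
  Position G = LoopFree G × (∀ x → deg G x ≡ deg H x)

  AngelReply : Graph n → Edge n → Set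
  AngelReply G e = Σ (Edge n) λ e' → e' ∈ G × NonIncident e e' × Σ Bool λ o → Σ Bool λ o' →
                   Position (doubleSwap o o' e e' G) × excess (doubleSwap o o' e e' G) < excess G

  swap-move : ∀ {G : Graph n} {e e' : Edge n} o o' {v₁ v₂ v₃ v₄} → Position G → e ∈ G → e' ∈ G →
    orient o e ≡ (v₁ , v₂) → orient o' e' ≡ (v₃ , v₄) → NonIncident (v₁ , v₂) (v₃ , v₄) →
    mult H v₁ v₂ < mult G v₁ v₂ → mult H v₃ v₄ < mult G v₃ v₄ → mult G v₂ v₃ < mult H v₂ v₃ →
    AngelReply G e
  swap-move {G} {e} {e'} o o' {v₁} {v₂} {v₃} {v₄} (lG , deg≡) e∈ e'∈ eo eo' ni@(_ , v₁≢v₄ , v₂≢v₃ , _)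
            s₁₂ s₃₄ d₂₃ =
    e' , e'∈ , ni-e , o , o' ,
    subst Position (sym swapped) (v₂≢v₃ ∷ (v₁≢v₄ ∘ sym) ∷ All-tail (All-tail lF) , deg′) ,
    subst (λ G′ → excess G′ < excess G) (sym swapped) decrease
    where
    R = removeOne e' (removeOne e G)
    swapped : doubleSwap o o' e e' G ≡ (v₂ , v₃) ∷ (v₄ , v₁) ∷ R
    swapped = doubleSwap-orient o o' e e' G eo eo'
    ni-e : NonIncident e e'
    ni-e = NonIncident-orient o o' e e' (subst₂ NonIncident (sym eo) (sym eo') ni)
    F = (v₁ , v₂) ∷ (v₃ , v₄) ∷ R
    source : (∀ x y → mult G x y ≡ mult F x y) × LoopFree F
    source = doubleSwap-source o o' lG e∈ e'∈ (NonIncident⇒≢ ni-e) eo eo'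
    G≈F : ∀ x y → mult G x y ≡ mult F x y
    G≈F = proj₁ source
    lF : LoopFree F
    lF = proj₂ source
    v₁≢v₂ : v₁ ≢ v₂
    v₁≢v₂ = All-head lF
    v₃≢v₄ : v₃ ≢ v₄
    v₃≢v₄ = All-head (All-tail lF)
    deg′ : ∀ x → deg ((v₂ , v₃) ∷ (v₄ , v₁) ∷ R) x ≡ deg H x
    deg′ x = trans (swap-deg R v₁≢v₂ v₃≢v₄ ni x) (trans (sym (deg-cong lG lF G≈F x)) (deg≡ x))
    decrease : excess ((v₂ , v₃) ∷ (v₄ , v₁) ∷ R) < excess G
    decrease = subst (excess ((v₂ , v₃) ∷ (v₄ , v₁) ∷ R) <_) (sym (excess-cong {G} {F} G≈F))
      (swap-excess R v₁≢v₂ v₃≢v₄ ni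
         (subst (_ <_) (G≈F v₁ v₂) s₁₂) (subst (_ <_) (G≈F v₃ v₄) s₃₄) (subst (_< _) (G≈F v₂ v₃) d₂₃))

  angel-reply : ∀ {G} → Position G → ∀ e → e ∈ G → mult H (proj₁ e) (proj₂ e) < mult G (proj₁ e) (proj₂ e) →
                AngelReply G e
  angel-reply {G} pos@(lG , deg≡) (a , b) e∈ surplus with SwapPartner.swap-partner lG lH deg≡ surplus
  ... | c , d , (c∉ , deficit) , d∉ , surplus-cd with member-of-type G (≤-<-trans z≤n surplus-cd)
  ...   | e' , e'∈ , t with orient-of-type e' t | deficit
  ...     | o' , eo' | inj₂ deficit-cb =
    swap-move false o' pos e∈ e'∈ refl eo' (avoids⇒NonIncident c∉ d∉) surplus surplus-cd (mult-comm-< G H deficit-cb)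
  ...     | o' , eo' | inj₁ deficit-ca =
    swap-move true o' pos e∈ e'∈ refl eo' (avoids⇒NonIncident (c∉ ∘ ⊎-swap) (d∉ ∘ ⊎-swap))
              (mult-comm-< H G surplus) surplus-cd (mult-comm-< G H deficit-ca)

  reached? : ∀ G → Dec (Reached H G)
  reached? G = all? (λ a → all? (λ b → mult G a b ≟ℕ mult H a b))

  angel-wins : ∀ G → Position G → Acc _<_ (excess G) → AngelWins H G
  angel-wins G pos (acc smaller) with reached? G
  ... | yes done = reached done
  ... | no ¬done = move ¬done λ e e∈ surplus →
    let (e' , e'∈ , ni , o , o' , pos′ , decrease) = angel-reply pos e e∈ surplus
    in e' , e'∈ , ni , o , o' , angel-wins _ pos′ (smaller decrease)

proposition4p1 : (n : ℕ) (H G : Graph n) → LoopFree H → LoopFree G →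
                   (∀ (x : Fin n) → deg G x ≡ deg H x) → AngelWins H G
proposition4p1 n H G lH lG deg≡ = Game.angel-wins H lH G (lG , deg≡) (<-wellFounded (Excess.excess H G))
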